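{- Let $k\ge1$ and let $u\in S_{k+1}$ have exactly one descent, at position $j$. Then the conjugate partition of $\theta(u)$ is \[ \theta(u)'=\big(k+1-j-\mathrm{Inv}_1(u),\ \dots,\ k+1-j-\mathrm{Inv}_j(u)\big). \]
   Context: Permutations in $S_{k+1}$ are in one-line notation; $w_\circ$ is the longest element; $\mathrm{Inv}_i(w)=\#\{j>i:w_i>w_j\}$; a descent of $w$ is an $i$ with $w_i>w_{i+1}$. The $k$-rectangles are $R_i=(i^{k+1-i})$, $i\in[k]$. A partition with parts $\le k$ is irreducible if it has at most $k-i$ parts equal to $i$ for every $i$; $\mu_\downarrow$ is obtained from $\mu$ by removing as many $k$-rectangles as possible. $\zeta(w)$ is the partition whose $i$-th column has length $\binom{k+1-i}{2}+\mathrm{Inv}_i(w_\circ w)$ for $i\in[k]$, and $\theta(w)=\zeta(w)_\downarrow$. -}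

module Defs where

open import Data.Nat using (ℕ; zero; suc; _+_; _∸_; _<_; _≤_; NonZero; _%_)
open import Data.Nat.Combinatorics using (_C_)
open import Data.Fin using (Fin; toℕ; inject₁) renaming (suc to fsuc; _<_ to _<ᶠ_)
open import Data.Fin.Permutation using (Permutation′; _⟨$⟩ʳ_; _∘ₚ_; reverse)
open import Data.List using (List; length; filter; map)
open import Data.Nat.ListAction using (sum)
open import Data.List.Base using (allFin)
open import Data.Product using (_×_)
open import Relation.Binary.PropositionalEquality using (_≡_)
open import Function.Bundles using (_⇔_)
import Data.Fin as F
open import Relation.Nullary.Decidable using (_×-dec_)

-- Conventions: S_{k+1} = Permutation′ (suc k); positions and values are
-- elements of Fin (suc k), i.e. 0-based: position i ↔ paper's position i+1,
-- and w ⟨$⟩ʳ i is the (0-based) value w_{i+1}.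

_at_ : ∀ {k} → Permutation′ (suc k) → Fin (suc k) → Fin (suc k)
w at i = w ⟨$⟩ʳ i

-- Longest element w∘ : i ↦ k+2-i (1-based), i.e. opposite (0-based).
w₀ : ∀ {k} → Permutation′ (suc k)
w₀ = reverse

-- The product w∘ w (apply w first, then w∘):  (w∘ w)_i = w∘(w_i).
w₀· : ∀ {k} → Permutation′ (suc k) → Permutation′ (suc k)
w₀· w = w ∘ₚ w₀

Inv : ∀ {k} → Permutation′ (suc k) → Fin (suc k) → ℕ
Inv w i = length (filter (λ j → (i F.<? j) ×-dec ((w at j) F.<? (w at i))) (allFin _))

-- i : Fin k (0-based; paper's position i+1 ∈ [k]) is a descent of w
-- iff w_{i+1} > w_{i+2} (1-based).
Descent : ∀ {k} → Permutation′ (suc k) → Fin k → Set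
Descent w i = (w at fsuc i) <ᶠ (w at inject₁ i)

OnlyDescentAt : ∀ {k} → Permutation′ (suc k) → Fin k → Set
OnlyDescentAt w j = ∀ i → Descent w i ⇔ (i ≡ j)

-- Partitions with all parts ≤ k, given by multiplicities:
-- m p = number of parts equal to (toℕ p + 1), for p : Fin k.
Mult : ℕ → Set
Mult k = Fin k → ℕ

-- Length of the column i (0-based; paper's column i+1) = number of parts
-- ≥ i+1.  This is also the (i+1)-th part of the conjugate partition.
col : ∀ {k} → Mult k → Fin k → ℕ
col {k} m i = sum (map m (filter (λ p → i F.≤? p) (allFin k)))

-- Height of the k-rectangle R_{p+1} = ((p+1)^{k-p}): k+1-(p+1) = k - p.
height : ∀ {k} → Fin k → ℕ
height {k} p = k ∸ toℕ p

height-nonZero : ∀ {k} (p : Fin k) → NonZero (height p)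
height-nonZero {suc k} Fin.zero = _
height-nonZero {suc k} (fsuc p) = height-nonZero {k} p

-- μ↓ : remove as many k-rectangles as possible.  Removing R_{p+1} lowers
-- the multiplicity of the part p+1 by its height k-p and touches nothing
-- else, so the result has multiplicity m p mod (k - p).
_↓ : ∀ {k} → Mult k → Mult k
(m ↓) p = _%_ (m p) (height p) {{height-nonZero p}}

ζ-col : ∀ {k} → Permutation′ (suc k) → Fin k → ℕ
ζ-col {k} w i = ((k ∸ toℕ i) C 2) + Inv (w₀· w) (inject₁ i)

-- μ is the partition ζ(w)  (a partition is determined by its columns).
IsZeta : ∀ {k} → Permutation′ (suc k) → Mult k → Set
IsZeta w μ = ∀ i → col μ i ≡ ζ-col w i

module Submission where

-- Write  I_p = Inv_p(u)  and  A_p = Inv_p(w∘ u).  Each later position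
-- is inverted in exactly one of  u,  w∘ u,  so  A_p + I_p = k - p.  Column  i
-- of  ζ(u)  has length  C(k-i,2) + A_i,  so the multiplicity of the part  i
-- is the difference of consecutive columns, which becomes
--     μ_i + I_i = height_i + I_{i+1}          (height_i = k - i).
-- Since  u  increases before and after  j,  I  is weakly increasing up to  j,
-- positive at  j,  and zero after  j.  Reducing  μ_i  mod  height_i  therefore
-- gives  I_{i+1} - I_i  before  j,  height_j - I_j  at  j  and  0  after  j,
-- and the columns of  θ(u)  telescope to  height_j - I_i  for  i ≤ j.

open import Defs
open import Data.Nat using (ℕ; suc; _+_; _≤_; _<_)
open import Data.Fin using (Fin; toℕ; inject₁)
open import Data.Fin.Permutation using (Permutation′)
open import Data.Product using (_×_)
open import Relation.Binary.PropositionalEquality using (_≡_)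

open import Level using (0ℓ)
open import Function using (_∘_)
open import Function.Bundles using (Equivalence)
open import Data.Nat using (zero; pred; _∸_; z≤n; s≤s; NonZero; _%_)
open import Data.Nat.Properties
open import Data.Nat.DivMod using (m<n⇒m%n≡m; [m+n]%n≡m%n; n%n≡0)
open import Data.Nat.Combinatorics using (_C_; nCk+nC[k+1]≡[n+1]C[k+1]; nC1≡n)
open import Data.Nat.ListAction using (sum)
open import Data.Nat.Tactic.RingSolver using (solve-∀)
open import Algebra.Properties.CommutativeSemigroup +-commutativeSemigroup using (x∙yz≈y∙xz; xy∙z≈y∙xz)
open import Data.Fin using () renaming (zero to fzero; suc to fsuc)
import Data.Fin as F
import Data.Fin.Properties as FP
open import Data.Fin.Permutation using (_⟨$⟩ˡ_; inverseˡ)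
open import Data.List using (List; []; _∷_; length; filter; map; tabulate)
open import Data.List.Base using (allFin)
open import Data.List.Properties using (length-map; map-∘; map-tabulate; length-tabulate; filter-all; filter-some; filter-≐)
open import Data.List.Relation.Unary.All.Properties using (tabulate⁺)
open import Data.List.Membership.Propositional using (lose)
open import Data.List.Membership.Propositional.Properties using (∈-allFin)
open import Data.List.Relation.Binary.Sublist.Propositional using (⊆-refl)
open import Data.List.Relation.Binary.Sublist.Propositional.Properties using (length-mono-≤; filter⁺)
open import Data.Sum using (_⊎_; inj₁; inj₂)
open import Data.Product using (_,_)
open import Relation.Nullary using (¬_; yes; no; contradiction)
open import Relation.Nullary.Decidable using (_×-dec_)
open import Relation.Unary using (Pred; Decidable)
open import Relation.Binary.Bundles using (Preorder)
open import Relation.Binary.Definitions using (tri<; tri≈; tri>)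
open import Relation.Binary.PropositionalEquality
open import Relation.Binary.PropositionalEquality.Properties using () renaming (preorder to ≡-preorder)

module _ {A : Set} {P Q R : Pred A 0ℓ} (P? : Decidable P) (Q? : Decidable Q) (R? : Decidable R) where

  count-split : (∀ x → P x → Q x ⊎ R x) → (∀ x → Q x → ¬ R x) → ∀ xs →
    length (filter (λ x → P? x ×-dec Q? x) xs) + length (filter (λ x → P? x ×-dec R? x) xs)
      ≡ length (filter P? xs)
  count-split cover disjoint [] = refl
  count-split cover disjoint (x ∷ xs) with P? x | Q? x | R? x
  ... | no _  | _     | _     = count-split cover disjoint xs
  ... | yes _ | yes q | yes r = contradiction r (disjoint x q)
  ... | yes _ | yes _ | no _  = cong suc (count-split cover disjoint xs)
  ... | yes _ | no _  | yes _ = trans (+-suc _ _) (cong suc (count-split cover disjoint xs))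
  ... | yes p | no ¬q | no ¬r with cover x p
  ...   | inj₁ q = contradiction q ¬q
  ...   | inj₂ r = contradiction r ¬r

count-mono : ∀ {A : Set} {P Q : Pred A 0ℓ} (P? : Decidable P) (Q? : Decidable Q) →
  (∀ x → P x → Q x) → ∀ xs → length (filter P? xs) ≤ length (filter Q? xs)
count-mono P? Q? P⇒Q xs = length-mono-≤ (filter⁺ P? Q? (λ { refl → P⇒Q _ }) (⊆-refl {x = xs}))

filter-map : ∀ {A B : Set} {P : Pred B 0ℓ} (P? : Decidable P) (f : A → B) (xs : List A) →
  filter P? (map f xs) ≡ map f (filter (λ x → P? (f x)) xs)
filter-map P? f [] = refl
filter-map P? f (x ∷ xs) with P? (f x)
... | yes _ = cong (f x ∷_) (filter-map P? f xs)
... | no _  = filter-map P? f xs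

filter-shifted : ∀ {n} {P : Pred (Fin (suc n)) 0ℓ} (P? : Decidable P) →
  filter P? (tabulate {n = n} fsuc) ≡ map fsuc (filter (λ x → P? (fsuc x)) (allFin n))
filter-shifted {n} P? =
  trans (cong (filter P?) (sym (map-tabulate {n = n} (λ x → x) fsuc))) (filter-map P? fsuc (allFin n))

count-after : ∀ {n} (i : Fin (suc n)) → length (filter (i F.<?_) (allFin (suc n))) ≡ n ∸ toℕ i
count-after {n} fzero = begin
  length (filter (fzero {n} F.<?_) (tabulate {n = n} fsuc)) ≡⟨ cong length (filter-shifted {n} (fzero {n} F.<?_)) ⟩
  length (map fsuc (filter after-0 (allFin n)))         ≡⟨ length-map fsuc (filter after-0 (allFin n)) ⟩
  length (filter after-0 (allFin n))                    ≡⟨ cong length (filter-all after-0 (tabulate⁺ {n = n} (λ _ → s≤s z≤n))) ⟩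
  length (allFin n)                                     ≡⟨ length-tabulate {n = n} (λ x → x) ⟩
  n                                                     ∎
  where
  open ≡-Reasoning
  after-0 : Decidable (λ (x : Fin n) → fzero {n} F.< fsuc x)
  after-0 x = fzero {n} F.<? fsuc x
count-after {suc n} (fsuc i) = begin
  length (filter (fsuc i F.<?_) (tabulate {n = suc n} fsuc)) ≡⟨ cong length (filter-shifted {suc n} (fsuc i F.<?_)) ⟩
  length (map fsuc (filter after-suc (allFin (suc n))))      ≡⟨ length-map fsuc (filter after-suc (allFin (suc n))) ⟩
  length (filter after-suc (allFin (suc n)))                 ≡⟨ cong length (filter-≐ after-suc (i F.<?_) (≤-pred , s≤s) (allFin (suc n))) ⟩
  length (filter (i F.<?_) (allFin (suc n)))                 ≡⟨ count-after i ⟩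
  n ∸ toℕ i                                                  ∎
  where
  open ≡-Reasoning
  after-suc : Decidable (λ (x : Fin (suc n)) → fsuc i F.< fsuc x)
  after-suc x = fsuc i F.<? fsuc x

module _ {c ℓ₁ ℓ₂} (𝒫 : Preorder c ℓ₁ ℓ₂) where
  open Preorder 𝒫 using (Carrier; _≲_) renaming (refl to ≲-refl; trans to ≲-trans)

  chain-consecutive : ∀ {n} (g : Fin (suc n) → Carrier) (a b : Fin (suc n)) → toℕ a ≤ toℕ b →
    (∀ (c : Fin n) → toℕ a ≤ toℕ c → toℕ c < toℕ b → g (inject₁ c) ≲ g (fsuc c)) → g a ≲ g b
  chain-consecutive g fzero fzero _ _ = ≲-refl
  chain-consecutive {zero} g fzero (fsuc ()) _ _
  chain-consecutive {suc n} g fzero (fsuc b) _ step =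
    ≲-trans (step fzero z≤n (s≤s z≤n))
            (chain-consecutive (λ x → g (fsuc x)) fzero b z≤n (λ c _ c<b → step (fsuc c) z≤n (s≤s c<b)))
  chain-consecutive {suc n} g (fsuc a) (fsuc b) (s≤s a≤b) step =
    chain-consecutive (λ x → g (fsuc x)) a b a≤b (λ c a≤c c<b → step (fsuc c) (s≤s a≤c) (s≤s c<b))

opposite-reverses : ∀ {n} {a b : Fin n} → a F.< b → F.opposite b F.< F.opposite a
opposite-reverses {a = a} {b} a<b = subst₂ _<_ (sym (FP.opposite-prop b)) (sym (FP.opposite-prop a))
  (∸-monoʳ-< (s≤s a<b) (FP.toℕ<n b))

Ascent : ∀ {k} → Permutation′ (suc k) → Fin k → Set
Ascent w c = (w at inject₁ c) F.< (w at fsuc c)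

module Inversions {k : ℕ} (w : Permutation′ (suc k)) where

  at-injective : ∀ {a b} → w at a ≡ w at b → a ≡ b
  at-injective {a} {b} e = trans (sym (inverseˡ w)) (trans (cong (w ⟨$⟩ˡ_) e) (inverseˡ w))

  -- Adjacent values are distinct, so every non-descent is an ascent.
  non-descent⇒ascent : ∀ c → ¬ Descent w c → Ascent w c
  non-descent⇒ascent c ¬desc with FP.<-cmp (w at inject₁ c) (w at fsuc c)
  ... | tri< asc _ _ = asc
  ... | tri≈ _ e _   = contradiction (cong toℕ (at-injective e))
                                     (<⇒≢ (subst (_< suc (toℕ c)) (sym (FP.toℕ-inject₁ c)) (n<1+n (toℕ c))))
  ... | tri> _ _ desc = contradiction desc ¬desc

  -- Every later position is inverted either in w or in w∘ w (never both),
  -- so  Inv_i(w∘ w) + Inv_i(w) = k - i.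
  Inv-complement : ∀ i → Inv (w₀· w) i + Inv w i ≡ k ∸ toℕ i
  Inv-complement i = trans
    (count-split (i F.<?_) (λ p → F.opposite (w at p) F.<? F.opposite (w at i)) (λ p → (w at p) F.<? (w at i))
                 cover disjoint (allFin (suc k)))
    (count-after i)
    where
    cover : ∀ p → i F.< p → F.opposite (w at p) F.< F.opposite (w at i) ⊎ (w at p) F.< (w at i)
    cover p i<p with FP.<-cmp (w at p) (w at i)
    ... | tri< lt _ _ = inj₂ lt
    ... | tri≈ _ e _  = contradiction (cong toℕ (at-injective e)) (≢-sym (<⇒≢ i<p))
    ... | tri> _ _ gt = inj₁ (opposite-reverses gt)
    disjoint : ∀ p → F.opposite (w at p) F.< F.opposite (w at i) → ¬ (w at p) F.< (w at i)
    disjoint p opp< lt = <-asym opp< (opposite-reverses lt)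

  Inv-bound : ∀ i → Inv w i ≤ k ∸ toℕ i
  Inv-bound i = subst (Inv w i ≤_) (Inv-complement i) (m≤n+m (Inv w i) (Inv (w₀· w) i))

  -- At an ascent  c,  every value below  w_c  to the right of  c + 1  is
  -- also below  w_{c+1}:  Inv_c(w) ≤ Inv_{c+1}(w).
  Inv-ascent : ∀ c → Ascent w c → Inv w (inject₁ c) ≤ Inv w (fsuc c)
  Inv-ascent c asc = count-mono
    (λ p → (inject₁ c F.<? p) ×-dec ((w at p) F.<? (w at inject₁ c)))
    (λ p → (fsuc c F.<? p) ×-dec ((w at p) F.<? (w at fsuc c))) shift (allFin (suc k))
    where
    shift : ∀ p → inject₁ c F.< p × (w at p) F.< (w at inject₁ c) → fsuc c F.< p × (w at p) F.< (w at fsuc c)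
    shift p (c<p , lt) with m≤n⇒m<n∨m≡n (subst (_< toℕ p) (FP.toℕ-inject₁ c) c<p)
    ... | inj₁ c+1<p = c+1<p , FP.<-trans lt asc
    ... | inj₂ c+1≡p = contradiction (subst (λ x → (w at x) F.< (w at inject₁ c)) (sym (FP.toℕ-injective c+1≡p)) lt)
                                     (<-asym asc)

  -- At a descent  c  the position  c + 1  itself is an inversion of  c.
  Inv-descent : ∀ c → Descent w c → 1 ≤ Inv w (inject₁ c)
  Inv-descent c desc = filter-some (λ p → (inject₁ c F.<? p) ×-dec ((w at p) F.<? (w at inject₁ c)))
    (lose (∈-allFin (fsuc c)) (subst (_< suc (toℕ c)) (sym (FP.toℕ-inject₁ c)) (n<1+n (toℕ c)) , desc))

  -- If  w  has only ascents from position  a  on, nothing after  a  is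
  -- inverted with it: chain  Inv-ascent  up to the last position.
  Inv-ascending : ∀ a → (∀ c → toℕ a ≤ toℕ c → Ascent w c) → Inv w a ≡ 0
  Inv-ascending a ascending = n≤0⇒n≡0 (begin
    Inv w a                  ≤⟨ chain-consecutive ≤-preorder (Inv w) a (F.fromℕ k) a≤last
                                  (λ c a≤c _ → Inv-ascent c (ascending c a≤c)) ⟩
    Inv w (F.fromℕ k)        ≤⟨ Inv-bound (F.fromℕ k) ⟩
    k ∸ toℕ (F.fromℕ k)      ≡⟨ cong (k ∸_) (FP.toℕ-fromℕ k) ⟩
    k ∸ k                    ≡⟨ n∸n≡0 k ⟩
    0                        ∎)
    where
    open ≤-Reasoning
    a≤last : toℕ a ≤ toℕ (F.fromℕ k)
    a≤last = subst (toℕ a ≤_) (sym (FP.toℕ-fromℕ k)) (≤-pred (FP.toℕ<n a))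

-- The number of parts of size  > n;  for  n = toℕ i  this is
-- the column  col μ i,  but  colFrom  also makes sense one past the last column.
colFrom : ∀ {k} → Mult k → ℕ → ℕ
colFrom {k} μ n = sum (map μ (filter (λ p → n ≤? toℕ p) (allFin k)))

≤-shift : ∀ n m → n ≤ suc m → pred n ≤ m
≤-shift zero    m _         = z≤n
≤-shift (suc n) m (s≤s n≤m) = n≤m

≤-unshift : ∀ n m → pred n ≤ m → n ≤ suc m
≤-unshift zero    m _   = z≤n
≤-unshift (suc n) m n≤m = s≤s n≤m

colFrom-tail : ∀ {k} (μ : Mult (suc k)) n →
  sum (map μ (filter (λ p → n ≤? toℕ p) (tabulate {n = k} fsuc))) ≡ colFrom (λ p → μ (fsuc p)) (pred n)
colFrom-tail {k} μ n = begin
  sum (map μ (filter above (tabulate fsuc)))                       ≡⟨ cong (sum ∘ map μ) (filter-shifted above) ⟩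
  sum (map μ (map fsuc (filter (λ x → above (fsuc x)) (allFin k)))) ≡⟨ cong sum (map-∘ (filter (λ x → above (fsuc x)) (allFin k))) ⟨
  sum (map (μ ∘ fsuc) (filter (λ x → above (fsuc x)) (allFin k)))  ≡⟨ cong (sum ∘ map (μ ∘ fsuc))
                                                                        (filter-≐ (λ x → above (fsuc x)) (λ x → pred n ≤? toℕ x)
                                                                          (≤-shift n _ , ≤-unshift n _) (allFin k)) ⟩
  colFrom (μ ∘ fsuc) (pred n)                                       ∎
  where
  open ≡-Reasoning
  above : Decidable (λ (p : Fin (suc k)) → n ≤ toℕ p)
  above p = n ≤? toℕ p

colFrom-step : ∀ {k} (μ : Mult k) (i : Fin k) → colFrom μ (toℕ i) ≡ μ i + colFrom μ (suc (toℕ i))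
colFrom-step μ fzero = cong (μ fzero +_) (trans (colFrom-tail μ 0) (sym (colFrom-tail μ 1)))
colFrom-step μ (fsuc i) = begin
  colFrom μ (suc (toℕ i))                            ≡⟨ colFrom-tail μ (suc (toℕ i)) ⟩
  colFrom (μ ∘ fsuc) (toℕ i)                         ≡⟨ colFrom-step (μ ∘ fsuc) i ⟩
  μ (fsuc i) + colFrom (μ ∘ fsuc) (suc (toℕ i))      ≡⟨ cong (μ (fsuc i) +_) (colFrom-tail μ (suc (suc (toℕ i)))) ⟨
  μ (fsuc i) + colFrom μ (suc (suc (toℕ i)))         ∎
  where open ≡-Reasoning

colFrom-vanish : ∀ {k} (μ : Mult k) n → (∀ p → n ≤ toℕ p → μ p ≡ 0) → colFrom μ n ≡ 0
colFrom-vanish {zero}  μ n       none = refl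
colFrom-vanish {suc k} μ zero    none = begin
  μ fzero + sum (map μ (filter (λ p → 0 ≤? toℕ p) (tabulate fsuc))) ≡⟨ cong₂ _+_ (none fzero z≤n) (colFrom-tail μ 0) ⟩
  0 + colFrom (μ ∘ fsuc) 0                                         ≡⟨ colFrom-vanish (μ ∘ fsuc) 0 (λ p _ → none (fsuc p) z≤n) ⟩
  0                                                                 ∎
  where open ≡-Reasoning
colFrom-vanish {suc k} μ (suc n) none = trans (colFrom-tail μ (suc n))
  (colFrom-vanish (μ ∘ fsuc) n (λ p n≤p → none (fsuc p) (s≤s n≤p)))

%-one-height-over : ∀ x a b h .{{_ : NonZero h}} → x + a ≡ h + b → a ≤ b → b < h → x % h + a ≡ b
%-one-height-over x a b h x+a≡h+b a≤b b<h = begin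
  x % h + a               ≡⟨ cong (λ y → y % h + a) x≡[b∸a]+h ⟩
  ((b ∸ a) + h) % h + a   ≡⟨ cong (_+ a) ([m+n]%n≡m%n (b ∸ a) h) ⟩
  (b ∸ a) % h + a         ≡⟨ cong (_+ a) (m<n⇒m%n≡m (≤-<-trans (m∸n≤m b a) b<h)) ⟩
  (b ∸ a) + a             ≡⟨ m∸n+n≡m a≤b ⟩
  b                       ∎
  where
  open ≡-Reasoning
  x≡[b∸a]+h : x ≡ (b ∸ a) + h
  x≡[b∸a]+h = +-cancelʳ-≡ a x ((b ∸ a) + h) (begin
    x + a               ≡⟨ x+a≡h+b ⟩
    h + b               ≡⟨ cong (h +_) (m∸n+n≡m a≤b) ⟨
    h + ((b ∸ a) + a)   ≡⟨ +-assoc h (b ∸ a) a ⟨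
    h + (b ∸ a) + a     ≡⟨ cong (_+ a) (+-comm h (b ∸ a)) ⟩
    (b ∸ a) + h + a     ∎)

%-below-height : ∀ x a h .{{_ : NonZero h}} → x + a ≡ h → 1 ≤ a → x % h + a ≡ h
%-below-height x a h x+a≡h 1≤a = trans (cong (_+ a) (m<n⇒m%n≡m x<h)) x+a≡h
  where
  x<h : x < h
  x<h = subst (x <_) x+a≡h (subst (_≤ x + a) (+-comm x 1) (+-monoʳ-≤ x 1≤a))

exchange : ∀ x n A A′ I I′ → x + A′ ≡ n + A → A + I ≡ suc n → A′ + I′ ≡ n → x + I ≡ suc n + I′
exchange x n A A′ I I′ x+A′≡n+A A+I≡1+n A′+I′≡n = +-cancelʳ-≡ (A′ + I′) (x + I) (suc n + I′) (begin
  (x + I) + (A′ + I′)       ≡⟨ regroup₁ x I A′ I′ ⟩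
  (x + A′) + (I + I′)       ≡⟨ cong (_+ (I + I′)) x+A′≡n+A ⟩
  (n + A) + (I + I′)        ≡⟨ regroup₂ n A I I′ ⟩
  (n + I′) + (A + I)        ≡⟨ cong ((n + I′) +_) A+I≡1+n ⟩
  (n + I′) + suc n          ≡⟨ regroup₃ n I′ ⟩
  (suc n + I′) + n          ≡⟨ cong ((suc n + I′) +_) A′+I′≡n ⟨
  (suc n + I′) + (A′ + I′)  ∎)
  where
  open ≡-Reasoning
  regroup₁ : ∀ x I A′ I′ → (x + I) + (A′ + I′) ≡ (x + A′) + (I + I′)
  regroup₁ = solve-∀
  regroup₂ : ∀ n A I I′ → (n + A) + (I + I′) ≡ (n + I′) + (A + I)
  regroup₂ = solve-∀
  regroup₃ : ∀ n I′ → (n + I′) + suc n ≡ (suc n + I′) + n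
  regroup₃ = solve-∀

module OneDescent {k : ℕ} (u : Permutation′ (suc k)) (j : Fin k) (only : OnlyDescentAt u j)
                  (μ : Mult k) (isζ : IsZeta u μ) where

  open Inversions u

  I : Fin (suc k) → ℕ
  I = Inv u

  A : Fin (suc k) → ℕ
  A = Inv (w₀· u)

  height-suc : ∀ (i : Fin k) → height i ≡ suc (k ∸ suc (toℕ i))
  height-suc i = +-∸-assoc 1 (FP.toℕ<n i)

  ascent-off-j : ∀ c → c ≢ j → Ascent u c
  ascent-off-j c c≢j = non-descent⇒ascent c (c≢j ∘ Equivalence.to (only c))

  -- u  is increasing after position  j + 1,  so  Inv_p(u) = 0  there.
  I-after : ∀ p → toℕ j < toℕ p → I p ≡ 0
  I-after p j<p = Inv-ascending p (λ c p≤c → ascent-off-j c (λ { refl → <⇒≱ j<p p≤c }))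

  -- The column formula for  ζ(u)  also holds one past the last column,
  -- where both sides vanish.
  ζ-column : ∀ (p : Fin (suc k)) → colFrom μ (toℕ p) ≡ (k ∸ toℕ p) C 2 + A p
  ζ-column p with k ≟ toℕ p
  ... | no k≢p = subst (λ q → colFrom μ (toℕ q) ≡ (k ∸ toℕ q) C 2 + A q) (FP.inject₁-lower₁ p k≢p)
                       (inner (F.lower₁ p k≢p))
    where
    inner : ∀ i → colFrom μ (toℕ (inject₁ i)) ≡ (k ∸ toℕ (inject₁ i)) C 2 + A (inject₁ i)
    inner i = trans (cong (colFrom μ) (FP.toℕ-inject₁ i))
              (trans (isζ i) (cong (λ n → (k ∸ n) C 2 + A (inject₁ i)) (sym (FP.toℕ-inject₁ i))))
  ... | yes k≡p = begin
    colFrom μ (toℕ p)          ≡⟨ cong (colFrom μ) (sym k≡p) ⟩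
    colFrom μ k                ≡⟨ colFrom-vanish μ k (λ i k≤i → contradiction (FP.toℕ<n i) (≤⇒≯ k≤i)) ⟩
    0 C 2 + 0                  ≡⟨ cong₂ (λ n a → n C 2 + a) k∸p≡0 A≡0 ⟨
    (k ∸ toℕ p) C 2 + A p      ∎
    where
    open ≡-Reasoning
    k∸p≡0 : k ∸ toℕ p ≡ 0
    k∸p≡0 = trans (cong (k ∸_) (sym k≡p)) (n∸n≡0 k)
    A≡0 : A p ≡ 0
    A≡0 = n≤0⇒n≡0 (subst (A p ≤_) k∸p≡0 (Inversions.Inv-bound (w₀· u) p))

  pascal : ∀ n → suc n C 2 ≡ n + n C 2
  pascal n = trans (sym (nCk+nC[k+1]≡[n+1]C[k+1] n 1)) (cong (_+ n C 2) (nC1≡n n))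

  -- The multiplicities of  ζ(u)  are differences of consecutive columns;
  -- rewritten with  Inv-complement  they read
  --   μ_i + Inv_i(u) = height_i + Inv_{i+1}(u).
  ζ-multiplicity : ∀ i → μ i + I (inject₁ i) ≡ height i + I (fsuc i)
  ζ-multiplicity i = subst (λ h → μ i + I (inject₁ i) ≡ h + I (fsuc i)) (sym (height-suc i))
    (exchange (μ i) n (A (inject₁ i)) (A (fsuc i)) (I (inject₁ i)) (I (fsuc i))
              column-difference complement-here (Inv-complement (fsuc i)))
    where
    n : ℕ
    n = k ∸ suc (toℕ i)
    complement-here : A (inject₁ i) + I (inject₁ i) ≡ suc n
    complement-here = trans (Inv-complement (inject₁ i))
                            (trans (cong (k ∸_) (FP.toℕ-inject₁ i)) (height-suc i))
    column-difference : μ i + A (fsuc i) ≡ n + A (inject₁ i)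
    column-difference = +-cancelˡ-≡ (n C 2) (μ i + A (fsuc i)) (n + A (inject₁ i)) (begin
      n C 2 + (μ i + A (fsuc i))      ≡⟨ x∙yz≈y∙xz (n C 2) (μ i) (A (fsuc i)) ⟩
      μ i + (n C 2 + A (fsuc i))      ≡⟨ cong (μ i +_) (ζ-column (fsuc i)) ⟨
      μ i + colFrom μ (suc (toℕ i))   ≡⟨ colFrom-step μ i ⟨
      colFrom μ (toℕ i)               ≡⟨ isζ i ⟩
      height i C 2 + A (inject₁ i)    ≡⟨ cong (λ h → h C 2 + A (inject₁ i)) (height-suc i) ⟩
      suc n C 2 + A (inject₁ i)       ≡⟨ cong (_+ A (inject₁ i)) (pascal n) ⟩
      (n + n C 2) + A (inject₁ i)     ≡⟨ xy∙z≈y∙xz n (n C 2) (A (inject₁ i)) ⟩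
      n C 2 + (n + A (inject₁ i))     ∎)
      where open ≡-Reasoning

  θ : Mult k
  θ = μ ↓

  θ-before : ∀ i → toℕ i < toℕ j → θ i + I (inject₁ i) ≡ I (fsuc i)
  θ-before i i<j = %-one-height-over (μ i) (I (inject₁ i)) (I (fsuc i)) (height i) {{height-nonZero i}}
    (ζ-multiplicity i)
    (Inv-ascent i (ascent-off-j i (λ { refl → <-irrefl refl i<j })))
    (subst (I (fsuc i) <_) (sym (height-suc i)) (s≤s (Inv-bound (fsuc i))))

  θ-at : θ j + I (inject₁ j) ≡ height j
  θ-at = %-below-height (μ j) (I (inject₁ j)) (height j) {{height-nonZero j}}
    (trans (ζ-multiplicity j) (trans (cong (height j +_) (I-after (fsuc j) (n<1+n (toℕ j)))) (+-identityʳ _)))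
    (Inv-descent j (Equivalence.from (only j) refl))

  θ-after : ∀ i → toℕ j < toℕ i → θ i ≡ 0
  θ-after i j<i = trans (cong (λ x → _%_ x (height i) {{height-nonZero i}}) μ≡height) (n%n≡0 (height i) {{height-nonZero i}})
    where
    μ≡height : μ i ≡ height i
    μ≡height = begin
      μ i                       ≡⟨ +-identityʳ (μ i) ⟨
      μ i + 0                   ≡⟨ cong (μ i +_) (I-after (inject₁ i) (subst (toℕ j <_) (sym (FP.toℕ-inject₁ i)) j<i)) ⟨
      μ i + I (inject₁ i)       ≡⟨ ζ-multiplicity i ⟩
      height i + I (fsuc i)     ≡⟨ cong (height i +_) (I-after (fsuc i) (<-trans j<i (n<1+n (toℕ i)))) ⟩
      height i + 0              ≡⟨ +-identityʳ (height i) ⟩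
      height i                  ∎
      where open ≡-Reasoning

  column+Inv : Fin (suc k) → ℕ
  column+Inv p = colFrom θ (toℕ p) + I p

  -- Before  j  each step trades  θ_i  against the growth of  Inv,
  column+Inv-step : ∀ c → toℕ c < toℕ j → column+Inv (inject₁ c) ≡ column+Inv (fsuc c)
  column+Inv-step c c<j = begin
    colFrom θ (toℕ (inject₁ c)) + I (inject₁ c)      ≡⟨ cong (λ n → colFrom θ n + I (inject₁ c)) (FP.toℕ-inject₁ c) ⟩
    colFrom θ (toℕ c) + I (inject₁ c)                ≡⟨ cong (_+ I (inject₁ c)) (colFrom-step θ c) ⟩
    (θ c + colFrom θ (suc (toℕ c))) + I (inject₁ c)  ≡⟨ xy∙z≈y∙xz (θ c) (colFrom θ (suc (toℕ c))) (I (inject₁ c)) ⟩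
    colFrom θ (suc (toℕ c)) + (θ c + I (inject₁ c))  ≡⟨ cong (colFrom θ (suc (toℕ c)) +_) (θ-before c c<j) ⟩
    colFrom θ (suc (toℕ c)) + I (fsuc c)             ∎
    where open ≡-Reasoning

  -- and at  j  the column is the single part  θ_j  (later parts vanish).
  column+Inv-at-j : column+Inv (inject₁ j) ≡ height j
  column+Inv-at-j = begin
    colFrom θ (toℕ (inject₁ j)) + I (inject₁ j)      ≡⟨ cong (λ n → colFrom θ n + I (inject₁ j)) (FP.toℕ-inject₁ j) ⟩
    colFrom θ (toℕ j) + I (inject₁ j)                ≡⟨ cong (_+ I (inject₁ j)) (colFrom-step θ j) ⟩
    (θ j + colFrom θ (suc (toℕ j))) + I (inject₁ j)  ≡⟨ cong (λ c → (θ j + c) + I (inject₁ j))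
                                                            (colFrom-vanish θ (suc (toℕ j)) θ-after) ⟩
    (θ j + 0) + I (inject₁ j)                        ≡⟨ cong (_+ I (inject₁ j)) (+-identityʳ (θ j)) ⟩
    θ j + I (inject₁ j)                              ≡⟨ θ-at ⟩
    height j                                         ∎
    where open ≡-Reasoning

  conjugate-before : ∀ i → toℕ i ≤ toℕ j → col θ i + I (inject₁ i) ≡ height j
  conjugate-before i i≤j = begin
    colFrom θ (toℕ i) + I (inject₁ i)  ≡⟨ cong (λ n → colFrom θ n + I (inject₁ i)) (FP.toℕ-inject₁ i) ⟨
    column+Inv (inject₁ i)             ≡⟨ chain-consecutive (≡-preorder ℕ) column+Inv (inject₁ i) (inject₁ j)
                                            (subst₂ _≤_ (sym (FP.toℕ-inject₁ i)) (sym (FP.toℕ-inject₁ j)) i≤j)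
                                            (λ c _ c<j → column+Inv-step c (subst (toℕ c <_) (FP.toℕ-inject₁ j) c<j)) ⟩
    column+Inv (inject₁ j)             ≡⟨ column+Inv-at-j ⟩
    height j                           ∎
    where open ≡-Reasoning

  conjugate-after : ∀ i → toℕ j < toℕ i → col θ i ≡ 0
  conjugate-after i j<i = colFrom-vanish θ (toℕ i) (λ p i≤p → θ-after p (<-≤-trans j<i i≤p))

lemma7p5 : (k : ℕ) → 1 ≤ k → (u : Permutation′ (suc k)) (j : Fin k) →
    OnlyDescentAt u j → (ζ : Mult k) → IsZeta u ζ →
    (∀ (i : Fin k) → toℕ i ≤ toℕ j →
       col (ζ ↓) i + (suc (toℕ j) + Inv u (inject₁ i)) ≡ suc k)
    × (∀ (i : Fin k) → toℕ j < toℕ i → col (ζ ↓) i ≡ 0)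
lemma7p5 k _ u j only ζ isζ = before , conjugate-after
  where
  open OneDescent u j only ζ isζ
  before : ∀ i → toℕ i ≤ toℕ j → col θ i + (suc (toℕ j) + I (inject₁ i)) ≡ suc k
  before i i≤j = begin
    col θ i + (suc (toℕ j) + I (inject₁ i))  ≡⟨ x∙yz≈y∙xz (col θ i) (suc (toℕ j)) (I (inject₁ i)) ⟩
    suc (toℕ j) + (col θ i + I (inject₁ i))  ≡⟨ cong (suc (toℕ j) +_) (conjugate-before i i≤j) ⟩
    suc (toℕ j) + (k ∸ toℕ j)                ≡⟨ cong suc (m+[n∸m]≡n (<⇒≤ (FP.toℕ<n j))) ⟩
    suc k                                    ∎
    where open ≡-Reasoning
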